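{- Let $n_0\ge 0$ be an integer and set $V_i(n_0)=\binom{n_0+2i}{i}$ for $i\ge0$. Let $m=n_0^2-\lceil n_0/2\rceil$. Then the finite sequence $V_0(n_0),V_1(n_0),\ldots,V_m(n_0)$ is log-concave, and the sequence $V_{j}(n_0),V_{j+1}(n_0),V_{j+2}(n_0),\ldots$ with $j=\max(m-1,0)$ is log-convex.
   Context: $\lceil x\rceil$ denotes the smallest integer $\ge x$. A sequence $a_s,a_{s+1},\ldots$ (finite or infinite) is log-concave if $a_{i-1}a_{i+1}\le a_i^2$ for every interior index $i$, and log-convex if $a_{i-1}a_{i+1}\ge a_i^2$ for every interior index $i$. -}

module Defs where

open import Data.Nat using (ℕ; suc; _+_; _*_; _∸_; _≤_; ⌈_/2⌉; _⊔_)
open import Data.Nat.Combinatorics using (_C_)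

V : ℕ → ℕ → ℕ
V n₀ i = (n₀ + 2 * i) C i

-- m = n₀² - ⌈n₀/2⌉   (truncated subtraction is harmless: n₀² ≥ ⌈n₀/2⌉)
mIdx : ℕ → ℕ
mIdx n₀ = n₀ * n₀ ∸ ⌈ n₀ /2⌉

-- finite sequence a_0..a_m log-concave: interior indices 1 ≤ i, i+1 ≤ m
LogConcaveUpTo : (ℕ → ℕ) → ℕ → Set
LogConcaveUpTo a m = ∀ i → 1 ≤ i → suc i ≤ m → a (i ∸ 1) * a (suc i) ≤ a i * a i

-- infinite sequence a_j, a_{j+1}, ... log-convex: interior indices i ≥ j+1
LogConvexFrom : (ℕ → ℕ) → ℕ → Set
LogConvexFrom a j = ∀ i → suc j ≤ i → a i * a i ≤ a (i ∸ 1) * a (suc i)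

module Submission where

-- Two absorption
-- identities for binomial coefficients give the ratio recurrence
--   den i · V (i+1) = num i · V i,  den i = (i+1)(n+i+1),  num i = (n+2i+2)(n+2i+1),
-- so V (i+1) / V i = num i / den i.  For any sequence with such a recurrence,
-- log-concavity (resp. log-convexity) at index k+1 follows from comparing the
-- consecutive ratios, i.e. from  den k · num (k+1) ≤ num k · den (k+1)  (resp. ≥).
-- With u = 2(k+1) + n + 1 and w = n² a polynomial identity shows
--   2·den k·num (k+1) + (2uw + 1) = 2·num k·den (k+1) + (u² + w),
-- so the comparison is decided by the sign of u² − 2uw + w − 1, which is ≤ 0
-- for 1 ≤ u < 2w and ≥ 0 for u ≥ 2w.  Finally, for c = ⌈n/2⌉ (indeed for any c
-- with n ≤ 2c ≤ n+1) the index range k+1 < m = n² − c forces u < 2w and the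
-- range k+1 ≥ m forces u ≥ 2w.

open import Defs
open import Data.Nat using (ℕ; zero; suc; _+_; _*_; _∸_; _≤_; _<_; ⌈_/2⌉; _⊔_; z≤n; s≤s; NonZero)
open import Data.Nat.Properties
open import Data.Nat.Combinatorics using (_C_; nCk+nC[k+1]≡[n+1]C[k+1]; nCk≡nC[n∸k]; nC1≡n)
open import Data.Nat.Tactic.RingSolver using (solve-∀)
open import Data.Product using (_×_; _,_)
open import Relation.Binary.PropositionalEquality using (_≡_; refl; sym; cong; cong₂; subst; module ≡-Reasoning)

absorption : ∀ n k → suc k * (suc n C suc k) ≡ suc n * (n C k)
absorption n       zero    = begin
  1 * (suc n C 1) ≡⟨ *-identityˡ _ ⟩
  suc n C 1       ≡⟨ nC1≡n (suc n) ⟩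
  suc n           ≡⟨ sym (*-identityʳ _) ⟩
  suc n * 1       ∎
  where open ≡-Reasoning
absorption zero    (suc k) = *-zeroʳ (suc (suc k))
absorption (suc n) (suc k) = begin
  suc (suc k) * (suc (suc n) C suc (suc k))
    ≡⟨ cong (suc (suc k) *_) (sym (nCk+nC[k+1]≡[n+1]C[k+1] (suc n) (suc k))) ⟩
  suc (suc k) * (x + y)
    ≡⟨ spread k x y ⟩
  suc k * x + x + suc (suc k) * y
    ≡⟨ cong₂ (λ a b → a + x + b) (absorption n k) (absorption n (suc k)) ⟩
  suc n * (n C k) + x + suc n * (n C suc k)
    ≡⟨ collect (suc n) (n C k) (n C suc k) x ⟩
  suc n * (n C k + n C suc k) + x
    ≡⟨ cong (λ a → suc n * a + x) (nCk+nC[k+1]≡[n+1]C[k+1] n k) ⟩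
  suc n * x + x
    ≡⟨ +-comm (suc n * x) x ⟩
  suc (suc n) * x ∎
  where
  open ≡-Reasoning
  x y : ℕ
  x = suc n C suc k
  y = suc n C suc (suc k)
  spread : ∀ j a b → suc (suc j) * (a + b) ≡ suc j * a + a + suc (suc j) * b
  spread = solve-∀
  collect : ∀ m a b d → m * a + d + m * b ≡ m * (a + b) + d
  collect = solve-∀

mirror : ∀ a b → (a + b) C b ≡ (a + b) C a
mirror a b = begin
  (a + b) C b           ≡⟨ nCk≡nC[n∸k] (m≤n+m b a) ⟩
  (a + b) C (a + b ∸ b) ≡⟨ cong ((a + b) C_) (m+n∸n≡m a b) ⟩
  (a + b) C a           ∎
  where open ≡-Reasoning

-- The mirror image of absorption: (n+1−k)·C(n+1, k) = (n+1)·C(n, k),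
-- written with n = m + k to avoid truncated subtraction.
absorption′ : ∀ m k → suc m * (suc (m + k) C k) ≡ suc (m + k) * ((m + k) C k)
absorption′ m k = begin
  suc m * (suc (m + k) C k)     ≡⟨ cong (suc m *_) (mirror (suc m) k) ⟩
  suc m * (suc (m + k) C suc m) ≡⟨ absorption (m + k) m ⟩
  suc (m + k) * ((m + k) C m)   ≡⟨ cong (suc (m + k) *_) (sym (mirror m k)) ⟩
  suc (m + k) * ((m + k) C k)   ∎
  where open ≡-Reasoning

den : ℕ → ℕ → ℕ
den n i = suc i * suc (n + i)

num : ℕ → ℕ → ℕ
num n i = suc (suc (n + 2 * i)) * suc (n + 2 * i)

ratio : ∀ n i → den n i * V n (suc i) ≡ num n i * V n i
ratio n i = begin
  (suc i * suc (n + i)) * ((n + 2 * suc i) C suc i)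
    ≡⟨ cong (λ t → (suc i * suc (n + i)) * (t C suc i)) (shift n i) ⟩
  (suc i * suc (n + i)) * (suc (suc N) C suc i)
    ≡⟨ reassoc (suc i) (suc (n + i)) (suc (suc N) C suc i) ⟩
  suc (n + i) * (suc i * (suc (suc N) C suc i))
    ≡⟨ cong (suc (n + i) *_) (absorption (suc N) i) ⟩
  suc (n + i) * (suc (suc N) * (suc N C i))
    ≡⟨ left-comm (suc (n + i)) (suc (suc N)) (suc N C i) ⟩
  suc (suc N) * (suc (n + i) * (suc N C i))
    ≡⟨ cong (suc (suc N) *_) absorption-N ⟩
  suc (suc N) * (suc N * (N C i))
    ≡⟨ sym (*-assoc (suc (suc N)) (suc N) (N C i)) ⟩
  (suc (suc N) * suc N) * (N C i) ∎
  where
  open ≡-Reasoning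
  N : ℕ
  N = n + 2 * i
  shift : ∀ n i → n + 2 * suc i ≡ suc (suc (n + 2 * i))
  shift = solve-∀
  reassoc : ∀ a b z → (a * b) * z ≡ b * (a * z)
  reassoc = solve-∀
  left-comm : ∀ a b z → a * (b * z) ≡ b * (a * z)
  left-comm = solve-∀
  twice : ∀ n i → n + i + i ≡ n + 2 * i
  twice = solve-∀
  absorption-N : suc (n + i) * (suc N C i) ≡ suc N * (N C i)
  absorption-N = subst (λ M → suc (n + i) * (suc M C i) ≡ suc M * (M C i)) (twice n i) (absorption′ (n + i) i)

module RatioComparison (v a b : ℕ → ℕ) (ratio-v : ∀ i → a i * v (suc i) ≡ b i * v i) where

  cross : ∀ k → (v k * v (suc (suc k))) * (b k * a (suc k))
              ≡ (v (suc k) * v (suc k)) * (a k * b (suc k))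
  cross k = begin
    (v k * v (suc (suc k))) * (b k * a (suc k))
      ≡⟨ interchange (v k) (v (suc (suc k))) (b k) (a (suc k)) ⟩
    (b k * v k) * (a (suc k) * v (suc (suc k)))
      ≡⟨ cong₂ _*_ (sym (ratio-v k)) (ratio-v (suc k)) ⟩
    (a k * v (suc k)) * (b (suc k) * v (suc k))
      ≡⟨ interchange′ (a k) (v (suc k)) (b (suc k)) ⟩
    (v (suc k) * v (suc k)) * (a k * b (suc k)) ∎
    where
    open ≡-Reasoning
    interchange : ∀ p q r s → (p * q) * (r * s) ≡ (r * p) * (s * q)
    interchange = solve-∀
    interchange′ : ∀ p q r → (p * q) * (r * q) ≡ (q * q) * (p * r)
    interchange′ = solve-∀

  concaveAt : ∀ k → .{{_ : NonZero (b k * a (suc k))}} → a k * b (suc k) ≤ b k * a (suc k) →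
              v k * v (suc (suc k)) ≤ v (suc k) * v (suc k)
  concaveAt k le = *-cancelʳ-≤ _ _ (b k * a (suc k)) (begin
    (v k * v (suc (suc k))) * (b k * a (suc k)) ≡⟨ cross k ⟩
    (v (suc k) * v (suc k)) * (a k * b (suc k)) ≤⟨ *-monoʳ-≤ (v (suc k) * v (suc k)) le ⟩
    (v (suc k) * v (suc k)) * (b k * a (suc k)) ∎)
    where open ≤-Reasoning

  convexAt : ∀ k → .{{_ : NonZero (a k * b (suc k))}} → b k * a (suc k) ≤ a k * b (suc k) →
             v (suc k) * v (suc k) ≤ v k * v (suc (suc k))
  convexAt k le = *-cancelʳ-≤ _ _ (a k * b (suc k)) (begin
    (v (suc k) * v (suc k)) * (a k * b (suc k)) ≡⟨ sym (cross k) ⟩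
    (v k * v (suc (suc k))) * (b k * a (suc k)) ≤⟨ *-monoʳ-≤ (v k * v (suc (suc k))) le ⟩
    (v k * v (suc (suc k))) * (a k * b (suc k)) ∎)
    where open ≤-Reasoning

-- The quantity u = 2i + n + 1 whose size relative to 2n² decides the shape
-- of V n at index i.
centre : ℕ → ℕ → ℕ
centre n i = suc (n + 2 * i)

-- The ratio comparison at k as a quadratic in u = centre n (k+1) and w = n².
crossRatio : ∀ n k →
  2 * (den n k * num n (suc k)) + (2 * centre n (suc k) * (n * n) + 1)
    ≡ 2 * (num n k * den n (suc k)) + (centre n (suc k) * centre n (suc k) + n * n)
crossRatio n k = expanded n k
  where
  expanded : ∀ n k →
    2 * ((suc k * suc (n + k)) * (suc (suc (n + 2 * suc k)) * suc (n + 2 * suc k)))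
      + (2 * suc (n + 2 * suc k) * (n * n) + 1)
    ≡ 2 * ((suc (suc (n + 2 * k)) * suc (n + 2 * k)) * (suc (suc k) * suc (n + suc k)))
      + (suc (n + 2 * suc k) * suc (n + 2 * suc k) + n * n)
  expanded = solve-∀

balance : ∀ {a b x y} → 2 * a + y ≡ 2 * b + x → x ≤ y → a ≤ b
balance {a} {b} {x} {y} eq x≤y = *-cancelˡ-≤ 2 (+-cancelʳ-≤ x (2 * a) (2 * b) (begin
  2 * a + x ≤⟨ +-monoʳ-≤ (2 * a) x≤y ⟩
  2 * a + y ≡⟨ eq ⟩
  2 * b + x ∎))
  where open ≤-Reasoning

-- Sign of u² − 2uw + w − 1 below the threshold: for 1 ≤ u < 2w it is ≤ 0.
-- Writing u = t+1 and 2w = u + r + 1, twice the gap 2uw + 1 − (u² + w)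
-- equals 2tr + t + r + 2.
quadBelow : ∀ u w → 1 ≤ u → u < 2 * w → u * u + w ≤ 2 * u * w + 1
quadBelow (suc t) w _ lt with m≤n⇒∃[o]m+o≡n lt
... | r , 2w≡ = *-cancelˡ-≤ 2 (begin
  2 * (u * u + w)                       ≡⟨ *-distribˡ-+ 2 (u * u) w ⟩
  2 * (u * u) + 2 * w                   ≡⟨ cong (2 * (u * u) +_) (sym 2w≡) ⟩
  2 * (u * u) + (suc u + r)             ≤⟨ m≤m+n _ (2 * t * r + t + r + 2) ⟩
  2 * (u * u) + (suc u + r) + (2 * t * r + t + r + 2)
                                        ≡⟨ slack t r ⟩
  2 * u * (suc u + r) + 2               ≡⟨ cong (λ z → 2 * u * z + 2) 2w≡ ⟩
  2 * u * (2 * w) + 2                   ≡⟨ halve (suc t) w ⟩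
  2 * (2 * u * w + 1)                   ∎)
  where
  open ≤-Reasoning
  u : ℕ
  u = suc t
  slack : ∀ t r → 2 * (suc t * suc t) + (suc (suc t) + r) + (2 * t * r + t + r + 2)
                ≡ 2 * suc t * (suc (suc t) + r) + 2
  slack = solve-∀
  halve : ∀ u w → 2 * u * (2 * w) + 2 ≡ 2 * (2 * u * w + 1)
  halve = solve-∀

-- Sign of u² − 2uw + w − 1 above the threshold: for 1 ≤ u and 2w ≤ u it is
-- ≥ 0, since with u = 2w + s it equals us + w − 1.
quadAbove : ∀ u w → 1 ≤ u → 2 * w ≤ u → 2 * u * w + 1 ≤ u * u + w
quadAbove u w 1≤u 2w≤u with m≤n⇒∃[o]m+o≡n 2w≤u
... | s , refl = begin
  2 * u * w + 1           ≤⟨ +-monoʳ-≤ (2 * u * w) (positive w s 1≤u) ⟩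
  2 * u * w + (u * s + w) ≡⟨ expand w s ⟩
  u * u + w               ∎
  where
  open ≤-Reasoning
  expand : ∀ w s → 2 * (2 * w + s) * w + ((2 * w + s) * s + w)
                   ≡ (2 * w + s) * (2 * w + s) + w
  expand = solve-∀
  -- us + w ≥ 1: if s = 0 then u = 2w forces w ≥ 1, otherwise us ≥ u ≥ 1.
  positive : ∀ w s → 1 ≤ 2 * w + s → 1 ≤ (2 * w + s) * s + w
  positive zero     zero    ()
  positive (suc w′) zero    _   = ≤-trans (s≤s z≤n) (m≤n+m (suc w′) _)
  positive w        (suc s) 1≤u =
    ≤-trans 1≤u (≤-trans (m≤m*n (2 * w + suc s) (suc s)) (m≤m+n _ w))

module _ (n : ℕ) where
  open RatioComparison (V n) (den n) (num n) (ratio n)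

  V-concaveAt : ∀ k → centre n (suc k) < 2 * (n * n) →
                V n k * V n (suc (suc k)) ≤ V n (suc k) * V n (suc k)
  V-concaveAt k lt =
    concaveAt k (balance (crossRatio n k) (quadBelow (centre n (suc k)) (n * n) (s≤s z≤n) lt))

  V-convexAt : ∀ k → 2 * (n * n) ≤ centre n (suc k) →
               V n (suc k) * V n (suc k) ≤ V n k * V n (suc (suc k))
  V-convexAt k le =
    convexAt k (balance (sym (crossRatio n k)) (quadAbove (centre n (suc k)) (n * n) (s≤s z≤n) le))

positive-∸ : ∀ {a b c} → suc a ≤ b ∸ c → suc a + c ≤ b
positive-∸ {a} {b} {c} le = m≤o∸n⇒m+n≤o (suc a) c≤b le
  where
  c≤b : c ≤ b
  c≤b = <⇒≤ (m∸n≢0⇒n<m (λ b∸c≡0 → n≮0 (subst (suc a ≤_) b∸c≡0 le)))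

concaveRange : ∀ n c i → n ≤ c + c → suc i ≤ n * n ∸ c → centre n i < 2 * (n * n)
concaveRange n c i n≤2c le = begin-strict
  suc (n + 2 * i)             <⟨ n<1+n _ ⟩
  suc (suc (n + 2 * i))       ≤⟨ s≤s (s≤s (+-monoˡ-≤ (2 * i) n≤2c)) ⟩
  suc (suc (c + c + 2 * i))   ≡⟨ regroup c i ⟩
  2 * (suc i + c)             ≤⟨ *-monoʳ-≤ 2 (positive-∸ le) ⟩
  2 * (n * n)                 ∎
  where
  open ≤-Reasoning
  regroup : ∀ c i → suc (suc (c + c + 2 * i)) ≡ 2 * (suc i + c)
  regroup = solve-∀

convexRange : ∀ n c i → c + c ≤ suc n → n * n ∸ c ≤ i → 2 * (n * n) ≤ centre n i
convexRange n c i 2c≤n+1 le = begin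
  2 * (n * n)             ≤⟨ *-monoʳ-≤ 2 (m≤n+m∸n (n * n) c) ⟩
  2 * (c + (n * n ∸ c))   ≤⟨ *-monoʳ-≤ 2 (+-monoʳ-≤ c le) ⟩
  2 * (c + i)             ≡⟨ regroup c i ⟩
  c + c + 2 * i           ≤⟨ +-monoˡ-≤ (2 * i) 2c≤n+1 ⟩
  suc (n + 2 * i)         ∎
  where
  open ≤-Reasoning
  regroup : ∀ c i → 2 * (c + i) ≡ c + c + 2 * i
  regroup = solve-∀

ceil-half-lower : ∀ n → n ≤ ⌈ n /2⌉ + ⌈ n /2⌉
ceil-half-lower n =
  subst (_≤ ⌈ n /2⌉ + ⌈ n /2⌉) (⌊n/2⌋+⌈n/2⌉≡n n) (+-monoˡ-≤ ⌈ n /2⌉ (⌊n/2⌋≤⌈n/2⌉ n))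

ceil-half-upper : ∀ n → ⌈ n /2⌉ + ⌈ n /2⌉ ≤ suc n
ceil-half-upper n =
  subst (⌈ n /2⌉ + ⌈ n /2⌉ ≤_) (⌊n/2⌋+⌈n/2⌉≡n (suc n)) (+-monoʳ-≤ ⌈ n /2⌉ (⌊n/2⌋≤⌈n/2⌉ (suc n)))

proposition4p2 : ∀ (n₀ : ℕ) →
    LogConcaveUpTo (V n₀) (mIdx n₀) × LogConvexFrom (V n₀) ((mIdx n₀ ∸ 1) ⊔ 0)
proposition4p2 n = concave , convex
  where
  concave : LogConcaveUpTo (V n) (mIdx n)
  concave zero    () _
  concave (suc k) _  le =
    V-concaveAt n k (concaveRange n ⌈ n /2⌉ (suc k) (ceil-half-lower n) le)

  -- the convex range starts at index m (at index 1 when m = 0)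
  m≤k+1 : ∀ k → suc ((mIdx n ∸ 1) ⊔ 0) ≤ suc k → mIdx n ≤ suc k
  m≤k+1 k le = ≤-trans (m≤n+m∸n (mIdx n) 1)
    (subst (λ j → suc j ≤ suc k) (⊔-identityʳ (mIdx n ∸ 1)) le)

  convex : LogConvexFrom (V n) ((mIdx n ∸ 1) ⊔ 0)
  convex zero    ()
  convex (suc k) le =
    V-convexAt n k (convexRange n ⌈ n /2⌉ (suc k) (ceil-half-upper n) (m≤k+1 k le))
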